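{- Let $X$ be a uniform multi-set of size $n$ that is 7-dense. Then there is an integer $1<v\le n$ such that the bucket $\mathcal{B}_{v,X}$ satisfies \[ |\mathcal{B}_{v,X}| \ge \frac{n}{3\mu_X} + \frac{n^2}{3\,v\,\mu_X\log(2n)}. \]
   Context: $X$ is a finite non-empty multi-set of positive integers; $n=|X|$ counts elements with multiplicity, $\max(X)$ is its maximum element, $\mu_X$ its largest multiplicity, and $\mathrm{supp}(X)$ the set of distinct integers in $X$. $X$ is $\delta$-dense if $|X|^2\ge\delta\cdot\mu_X\cdot\max(X)$. $X$ is uniform if every $x\in X$ has multiplicity exactly $\mu_X$. For a uniform $X$ and integer $z$, $f_X(z) := \mu_X\cdot|\{(x,x')\in\mathrm{supp}(X)\times\mathrm{supp}(X)\mid x+x'=z\}|$, and for an integer $v\ge1$ the bucket is $\mathcal{B}_{v,X} := \{z\in\mathbb{N}\mid f_X(z)\ge v\}$. -}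

module Defs where

open import Data.Nat using (ℕ; zero; suc; _+_; _*_; _∸_; _^_; _≤_; _<_; _⊔_; _≟_; _≤?_)
open import Data.List using (List; []; _∷_; length; filter; map; foldr; upTo; deduplicate)
open import Data.Nat.ListAction using (sum)
open import Data.Product using (_×_)
open import Data.List.Membership.Propositional using (_∈_)
open import Relation.Binary.PropositionalEquality using (_≡_)

-- A finite multi-set of integers is represented by a list (order irrelevant,
-- repetitions = multiplicities).

mult : ℕ → List ℕ → ℕ
mult x X = length (filter (x ≟_) X)

size : List ℕ → ℕ
size = length

maxX : List ℕ → ℕ
maxX = foldr _⊔_ 0

μ : List ℕ → ℕ
μ X = foldr _⊔_ 0 (map (λ x → mult x X) X)

supp : List ℕ → List ℕ
supp = deduplicate _≟_

Dense : ℕ → List ℕ → Set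
Dense δ X = δ * μ X * maxX X ≤ size X * size X

Uniform : List ℕ → Set
Uniform X = ∀ x → x ∈ X → mult x X ≡ μ X

pairCount : List ℕ → ℕ → ℕ
pairCount X z = sum (map (λ x → length (filter (λ x' → x + x' ≟ z) (supp X))) (supp X))

f : List ℕ → ℕ → ℕ
f X z = μ X * pairCount X z

-- |B_{v,X}| = |{z ∈ ℕ | f_X(z) ≥ v}|.  For v ≥ 1 every such z satisfies
-- z ≤ 2·max(X) (f_X(z) = 0 otherwise), so counting z ∈ {0,…,2·max(X)} is exact.
bucketSize : ℕ → List ℕ → ℕ
bucketSize v X = length (filter (λ z → v ≤? f X z) (upTo (suc (2 * maxX X))))

-- ExpLe a M  encodes  e^a ≤ M  (natural exponential, a M naturals):
-- e^a = sup_{k≥1} (1 + 1/k)^(k·a) (increasing sequence), so e^a ≤ M iff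
-- for all k ≥ 1, (k+1)^(k·a) ≤ M · k^(k·a).
ExpLe : ℕ → ℕ → Set
ExpLe a M = ∀ j → suc (suc j) ^ (suc j * a) ≤ M * suc j ^ (suc j * a)

-- BucketBound v X encodes (with n = |X|, μ = μ_X, B = |B_{v,X}|, v ≥ 1, n ≥ 1)
--     B ≥ n/(3μ) + n²/(3 v μ ln(2n)).
-- Multiplying by 3vμ·ln(2n) > 0 this is  ln(2n)·v·(3μB − n) ≥ n², which holds iff
-- 3μB > n and e^{n²} ≤ (2n)^{v·(3μB − n)}.
BucketBound : ℕ → List ℕ → Set
BucketBound v X =
  (size X < 3 * μ X * bucketSize v X) × ExpLe (size X * size X) ((2 * size X) ^ (v * (3 * μ X * bucketSize v X ∸ size X)))

{-# OPTIONS --safe #-}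
-- Let s = |supp X|, let r z = pairCount X z count the pairs of supp X × supp X with sum z, and
-- let N t = levelCount X t count the sums z with r z ≥ t.  Then n = s μ, r z ≤ s, the bucket at
-- v = μ t has N t elements, and double counting gives N 1 + ⋯ + N s = ∑_z r z = s².
-- Call a level t good when (14/5)^(s²) ≤ (2n)^(t (3 N t − s)); since e < 14/5, a good level
-- gives the bound for v = μ t.  If every level 1 ≤ t ≤ s were bad, dividing the bad bound at t
-- by t and summing over t, with ∑_t (3 N t − s) ≥ 2 s², would give (2n)² < (14/5)^(H_s), H_s
-- the harmonic number; but (1 + 1/t)^(t+1) ≥ 5/2 gives (14/5)^(H_s) < (2s)² ≤ (2n)².  If μ = 1
-- the level must be at least 2: density gives 7 N 1 ≤ 14 max X ≤ 2 s², so the levels t ≥ 2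
-- still carry (8/7) s², and the same argument runs with (14/5)^(7 (H_s − 1)) < (2s)^8.
-- Division is avoided by raising the bound at level t to the power s!/t before multiplying.
module Submission where

open import Defs
open import Data.Bool using (Bool; true; false)
open import Data.List using (List; []; _∷_; length; map; filter; upTo; applyUpTo)
open import Data.List.Membership.Propositional using (_∈_; lose)
open import Data.List.Membership.Propositional.Properties using (∈-deduplicate⁻; ∈-deduplicate⁺; ∈-upTo⁺)
open import Data.List.Properties using (length-filter; filter-some; filter-reject; filter-none; filter-≐; length-applyUpTo)
open import Data.List.Relation.Unary.All as All using (All; []; _∷_)
open import Data.List.Relation.Unary.All.Properties using (all-filter)
open import Data.List.Relation.Unary.AllPairs using ([]; _∷_)
open import Data.List.Relation.Unary.Any using (here; there)
open import Data.List.Relation.Unary.Unique.Propositional using (Unique)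
open import Data.List.Relation.Unary.Unique.Propositional.Properties using (filter⁺)
open import Data.Nat
open import Data.Nat.ListAction using (sum)
open import Data.Nat.Properties
open import Data.Nat.Tactic.RingSolver using (solve-∀)
open import Data.Product using (Σ; ∃-syntax; _×_; _,_)
open import Function using (_∘_)
open import Level using (0ℓ)
open import Relation.Binary.PropositionalEquality
open import Relation.Nullary using (¬_; does; yes; no; contradiction)
open import Relation.Nullary.Decidable using (_×-dec_; from-yes; dec-true; dec-false)
open import Relation.Unary using (Pred; Decidable)
open import Algebra.Properties.CommutativeSemigroup *-commutativeSemigroup
  using (interchange; x∙yz≈y∙xz; xy∙z≈x∙zy; xy∙z≈xz∙y)
import Algebra.Properties.CommutativeSemigroup +-commutativeSemigroup as +-CS
open import Data.List.Relation.Unary.Unique.DecPropositional.Properties _≟_ using (deduplicate-!; upTo⁺)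


^-distribʳ-* : ∀ m n k → (m * n) ^ k ≡ m ^ k * n ^ k
^-distribʳ-* m n zero    = refl
^-distribʳ-* m n (suc k) = begin
  m * n * (m * n) ^ k      ≡⟨ cong (m * n *_) (^-distribʳ-* m n k) ⟩
  m * n * (m ^ k * n ^ k)  ≡⟨ interchange m n (m ^ k) (n ^ k) ⟩
  m * m ^ k * (n * n ^ k)  ∎
  where open ≡-Reasoning

^-comm : ∀ x a b → (x ^ a) ^ b ≡ (x ^ b) ^ a
^-comm x a b = trans (^-*-assoc x a b) (trans (cong (x ^_) (*-comm a b)) (sym (^-*-assoc x b a)))

^-*-assoc′ : ∀ x a b → x ^ (a * b) ≡ (x ^ b) ^ a
^-*-assoc′ x a b = trans (cong (x ^_) (*-comm a b)) (sym (^-*-assoc x b a))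

^-*-swap : ∀ x a b c → (x ^ (a * b)) ^ c ≡ (x ^ (a * c)) ^ b
^-*-swap x a b c = begin
  (x ^ (a * b)) ^ c  ≡⟨ cong (_^ c) (^-*-assoc x a b) ⟨
  ((x ^ a) ^ b) ^ c  ≡⟨ ^-comm (x ^ a) b c ⟩
  ((x ^ a) ^ c) ^ b  ≡⟨ cong (_^ b) (^-*-assoc x a c) ⟩
  (x ^ (a * c)) ^ b  ∎
  where open ≡-Reasoning

^-combine : ∀ x a b m n → x ^ (m * a + n * b) ≡ (x ^ a) ^ m * (x ^ b) ^ n
^-combine x a b m n = trans (^-distribˡ-+-* x (m * a) (n * b)) (cong₂ _*_ (^-*-assoc′ x m a) (^-*-assoc′ x n b))

^-combine₂ : ∀ x y a b c d m n →
  x ^ (m * a + n * c) * y ^ (m * b + n * d) ≡ (x ^ a * y ^ b) ^ m * (x ^ c * y ^ d) ^ n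
^-combine₂ x y a b c d m n = begin
  x ^ (m * a + n * c) * y ^ (m * b + n * d)                ≡⟨ cong₂ _*_ (^-combine x a c m n) (^-combine y b d m n) ⟩
  (x ^ a) ^ m * (x ^ c) ^ n * ((y ^ b) ^ m * (y ^ d) ^ n)  ≡⟨ interchange ((x ^ a) ^ m) _ _ _ ⟩
  (x ^ a) ^ m * (y ^ b) ^ m * ((x ^ c) ^ n * (y ^ d) ^ n)  ≡⟨ cong₂ _*_ (^-distribʳ-* (x ^ a) (y ^ b) m) (^-distribʳ-* (x ^ c) (y ^ d) n) ⟨
  (x ^ a * y ^ b) ^ m * (x ^ c * y ^ d) ^ n                ∎
  where open ≡-Reasoning

^-cancelˡ-≤ : ∀ {m o} n .{{_ : NonZero n}} → m ^ n ≤ o ^ n → m ≤ o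
^-cancelˡ-≤ n mⁿ≤oⁿ = ≮⇒≥ (λ o<m → <⇒≱ (^-monoˡ-< n o<m) mⁿ≤oⁿ)

^-bound-scale : ∀ {a b M q E} c → a ^ q ≤ b ^ q * M ^ E → a ^ (q * c) ≤ b ^ (q * c) * M ^ (E * c)
^-bound-scale {a} {b} {M} {q} {E} c aᵠ≤bᵠMᴱ = begin
  a ^ (q * c)                ≡⟨ ^-*-assoc a q c ⟨
  (a ^ q) ^ c                ≤⟨ ^-monoˡ-≤ c aᵠ≤bᵠMᴱ ⟩
  (b ^ q * M ^ E) ^ c        ≡⟨ ^-distribʳ-* (b ^ q) (M ^ E) c ⟩
  (b ^ q) ^ c * (M ^ E) ^ c  ≡⟨ cong₂ _*_ (^-*-assoc b q c) (^-*-assoc M E c) ⟩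
  b ^ (q * c) * M ^ (E * c)  ∎
  where open ≤-Reasoning


-- Bernoulli inequalities and the sequence (1 + 1/k)^k

bernoulli : ∀ N m → N ^ m * (N + m) ≤ N * suc N ^ m
bernoulli N zero    = ≤-reflexive (base N)
  where
  base : ∀ N → 1 * (N + 0) ≡ N * 1
  base = solve-∀
bernoulli N (suc m) = begin
  N * x * (N + suc m)          ≤⟨ m≤m+n _ (x * m) ⟩
  N * x * (N + suc m) + x * m  ≡⟨ regroup N x m ⟩
  x * (N + m) * suc N          ≤⟨ *-monoˡ-≤ (suc N) (bernoulli N m) ⟩
  N * suc N ^ m * suc N        ≡⟨ xy∙z≈x∙zy N (suc N ^ m) (suc N) ⟩
  N * suc N ^ suc m            ∎
  where
  open ≤-Reasoning
  x = N ^ m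
  regroup : ∀ N x m → N * x * (N + suc m) + x * m ≡ x * (N + m) * suc N
  regroup = solve-∀

bernoulli₂ : ∀ s k → s ^ suc k * (2 * s * s + 2 * suc k * s + suc k * k) ≤ 2 * s * s * suc s ^ suc k
bernoulli₂ s zero    = ≤-reflexive (base s)
  where
  base : ∀ s → s * 1 * (2 * s * s + 2 * 1 * s + 1 * 0) ≡ 2 * s * s * (suc s * 1)
  base = solve-∀
bernoulli₂ s (suc k) = begin
  s * x * Q (suc k)                    ≤⟨ m≤m+n _ (x * (suc k * k)) ⟩
  s * x * Q (suc k) + x * (suc k * k)  ≡⟨ regroup s x k ⟩
  x * Q k * suc s                      ≤⟨ *-monoˡ-≤ (suc s) (bernoulli₂ s k) ⟩
  2 * s * s * suc s ^ suc k * suc s    ≡⟨ xy∙z≈x∙zy (2 * s * s) (suc s ^ suc k) (suc s) ⟩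
  2 * s * s * suc s ^ suc (suc k)      ∎
  where
  open ≤-Reasoning
  x = s ^ suc k
  Q : ℕ → ℕ
  Q k = 2 * s * s + 2 * suc k * s + suc k * k
  regroup : ∀ s x k → s * x * (2 * s * s + 2 * suc (suc k) * s + suc (suc k) * suc k) + x * (suc k * k)
                      ≡ x * (2 * s * s + 2 * suc k * s + suc k * k) * suc s
  regroup = solve-∀

-- compound⁺ names (1 + 1/k)^(k+1) and compound names (1 + 1/k)^k; comparisons with rationals
-- P/Q are cross-multiplied.
compound⁺≥5/2 : ∀ s → 5 * s ^ suc s ≤ 2 * suc s ^ suc s
compound⁺≥5/2 zero      = z≤n
compound⁺≥5/2 s@(suc _) = *-cancelʳ-≤ _ _ (s * s) (begin
  5 * x * (s * s)                                      ≤⟨ m≤m+n _ (3 * x * s) ⟩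
  5 * x * (s * s) + 3 * x * s                          ≡⟨ regroup s x ⟩
  x * (2 * s * s + 2 * suc s * s + suc s * s)          ≤⟨ bernoulli₂ s s ⟩
  2 * s * s * suc s ^ suc s                            ≡⟨ regroup′ s (suc s ^ suc s) ⟩
  2 * suc s ^ suc s * (s * s)                          ∎)
  where
  open ≤-Reasoning
  x = s ^ suc s
  regroup : ∀ s x → 5 * x * (s * s) + 3 * x * s ≡ x * (2 * s * s + 2 * suc s * s + suc s * s)
  regroup = solve-∀
  regroup′ : ∀ s y → 2 * s * s * y ≡ 2 * y * (s * s)
  regroup′ = solve-∀

-- Bernoulli's inequality for N = k (k + 2), where N + 1 = (k + 1)².
compound⁺-decreasing : ∀ k .{{_ : NonZero k}} →
  k ^ suc k * suc (suc k) ^ suc (suc k) ≤ suc k ^ suc k * suc k ^ suc (suc k)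
compound⁺-decreasing k = *-cancelʳ-≤ _ _ N {{m*n≢0 k (suc (suc k))}} (begin
  a * (suc (suc k) * b) * N          ≡⟨ shuffle a b (suc (suc k)) N ⟩
  a * b * (N * suc (suc k))          ≤⟨ *-monoʳ-≤ (a * b) (n≤1+n _) ⟩
  a * b * suc (N * suc (suc k))      ≡⟨ cong₂ _*_ (^-distribʳ-* k (suc (suc k)) (suc k)) (expand k) ⟨
  N ^ suc k * ((N + suc k) * suc k)  ≡⟨ *-assoc (N ^ suc k) _ (suc k) ⟨
  N ^ suc k * (N + suc k) * suc k    ≤⟨ *-monoˡ-≤ (suc k) (bernoulli N (suc k)) ⟩
  N * suc N ^ suc k * suc k          ≡⟨ cong (λ u → N * u * suc k) [1+N]ᵏ⁺¹≡c² ⟩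
  N * (c * c) * suc k                ≡⟨ shuffle′ N c (suc k) ⟩
  c * (suc k * c) * N                ∎)
  where
  open ≤-Reasoning
  N = k * suc (suc k)
  a = k ^ suc k
  b = suc (suc k) ^ suc k
  c = suc k ^ suc k
  shuffle : ∀ a b m N → a * (m * b) * N ≡ a * b * (N * m)
  shuffle = solve-∀
  shuffle′ : ∀ N c m → N * (c * c) * m ≡ c * (m * c) * N
  shuffle′ = solve-∀
  expand : ∀ k → (k * suc (suc k) + suc k) * suc k ≡ suc (k * suc (suc k) * suc (suc k))
  expand = solve-∀
  square : ∀ k → suc (k * suc (suc k)) ≡ suc k * suc k
  square = solve-∀
  [1+N]ᵏ⁺¹≡c² : suc N ^ suc k ≡ c * c
  [1+N]ᵏ⁺¹≡c² = trans (cong (_^ suc k) (square k)) (^-distribʳ-* (suc k) (suc k) (suc k))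

compound⁺-step : ∀ P Q k .{{_ : NonZero k}} → P * suc k ^ suc k ≤ Q * k ^ suc k →
  P * suc (suc k) ^ suc (suc k) ≤ Q * suc k ^ suc (suc k)
compound⁺-step P Q k h = *-cancelʳ-≤ _ _ (k ^ suc k) {{m^n≢0 k (suc k)}} (begin
  P * suc (suc k) ^ suc (suc k) * k ^ suc k    ≡⟨ xy∙z≈x∙zy P _ _ ⟩
  P * (k ^ suc k * suc (suc k) ^ suc (suc k))  ≤⟨ *-monoʳ-≤ P (compound⁺-decreasing k) ⟩
  P * (suc k ^ suc k * suc k ^ suc (suc k))    ≡⟨ *-assoc P _ _ ⟨
  P * suc k ^ suc k * suc k ^ suc (suc k)      ≤⟨ *-monoˡ-≤ _ h ⟩
  Q * k ^ suc k * suc k ^ suc (suc k)          ≡⟨ xy∙z≈xz∙y Q _ _ ⟩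
  Q * suc k ^ suc (suc k) * k ^ suc k          ∎)
  where open ≤-Reasoning

compound⁺-antitone : ∀ P Q {j k} .{{_ : NonZero j}} → j ≤′ k →
  P * suc j ^ suc j ≤ Q * j ^ suc j → P * suc k ^ suc k ≤ Q * k ^ suc k
compound⁺-antitone P Q (≤′-reflexive refl) h = h
compound⁺-antitone P Q {j} {suc k} (≤′-step j≤′k) h =
  compound⁺-step P Q k {{>-nonZero (≤-trans (>-nonZero⁻¹ j) (≤′⇒≤ j≤′k))}} (compound⁺-antitone P Q j≤′k h)

compound⁺⇒compound : ∀ P Q k .{{_ : NonZero k}} → P * suc k ^ suc k ≤ Q * k ^ suc k → P * suc k ^ k ≤ Q * k ^ k
compound⁺⇒compound P Q k h = *-cancelʳ-≤ _ _ k (begin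
  P * suc k ^ k * k      ≤⟨ *-monoʳ-≤ (P * suc k ^ k) (n≤1+n k) ⟩
  P * suc k ^ k * suc k  ≡⟨ xy∙z≈x∙zy P (suc k ^ k) (suc k) ⟩
  P * suc k ^ suc k      ≤⟨ h ⟩
  Q * k ^ suc k          ≡⟨ xy∙z≈x∙zy Q (k ^ k) k ⟨
  Q * k ^ k * k          ∎)
  where open ≤-Reasoning

-- (1 + 1/k)^(k+1) first drops below 14/5 at k = 17; smaller k are checked by evaluation.
compound≤14/5 : ∀ k → 5 * suc k ^ k ≤ 14 * k ^ k
compound≤14/5 k with k <? 17
... | yes k<17 = from-yes (allUpTo? (λ k → 5 * suc k ^ k ≤? 14 * k ^ k) 17) k<17
... | no  k≮17 = compound⁺⇒compound 5 14 k {{>-nonZero (≤-trans z<s 17≤k)}}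
                   (compound⁺-antitone 5 14 (≤⇒≤′ 17≤k) (from-yes (5 * 18 ^ 18 ≤? 14 * 17 ^ 18)))
  where 17≤k = ≮⇒≥ k≮17

ExpLe-from-14/5 : ∀ a M → 14 ^ a ≤ 5 ^ a * M → ExpLe a M
ExpLe-from-14/5 a M h j = *-cancelˡ-≤ (5 ^ a) {{m^n≢0 5 a}} (begin
  5 ^ a * suc k ^ (k * a)    ≡⟨ cong (5 ^ a *_) (^-*-assoc (suc k) k a) ⟨
  5 ^ a * (suc k ^ k) ^ a    ≡⟨ ^-distribʳ-* 5 (suc k ^ k) a ⟨
  (5 * suc k ^ k) ^ a        ≤⟨ ^-monoˡ-≤ a (compound≤14/5 k) ⟩
  (14 * k ^ k) ^ a           ≡⟨ ^-distribʳ-* 14 (k ^ k) a ⟩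
  14 ^ a * (k ^ k) ^ a       ≤⟨ *-monoˡ-≤ _ h ⟩
  5 ^ a * M * (k ^ k) ^ a    ≡⟨ trans (*-assoc (5 ^ a) M _) (cong (λ u → 5 ^ a * (M * u)) (^-*-assoc k k a)) ⟩
  5 ^ a * (M * k ^ (k * a))  ∎)
  where
  open ≤-Reasoning
  k = suc j


-- Sums over levels 1 ≤ t ≤ s and harmonic sums

sum₁ : ℕ → (ℕ → ℕ) → ℕ
sum₁ zero    f = 0
sum₁ (suc s) f = sum₁ s f + f (suc s)

sum₁-cong : ∀ s {f g : ℕ → ℕ} → (∀ t → f t ≡ g t) → sum₁ s f ≡ sum₁ s g
sum₁-cong zero    f≗g = refl
sum₁-cong (suc s) f≗g = cong₂ _+_ (sum₁-cong s f≗g) (f≗g (suc s))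

sum₁-distribˡ-* : ∀ c s f → sum₁ s (λ t → c * f t) ≡ c * sum₁ s f
sum₁-distribˡ-* c zero    f = sym (*-zeroʳ c)
sum₁-distribˡ-* c (suc s) f =
  trans (cong (_+ c * f (suc s)) (sum₁-distribˡ-* c s f)) (sym (*-distribˡ-+ c _ _))

sum₁[f]≤s*c+sum₁[f∸c] : ∀ s f c → sum₁ s f ≤ s * c + sum₁ s (λ t → f t ∸ c)
sum₁[f]≤s*c+sum₁[f∸c] zero    f c = z≤n
sum₁[f]≤s*c+sum₁[f∸c] (suc s) f c = begin
  sum₁ s f + f (suc s)                                   ≤⟨ +-mono-≤ (sum₁[f]≤s*c+sum₁[f∸c] s f c) (m≤n+m∸n (f (suc s)) c) ⟩
  (s * c + sum₁ s (λ t → f t ∸ c)) + (c + (f (suc s) ∸ c)) ≡⟨ +-CS.interchange (s * c) _ c _ ⟩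
  (s * c + c) + sum₁ (suc s) (λ t → f t ∸ c)             ≡⟨ cong (_+ sum₁ (suc s) (λ t → f t ∸ c)) (+-comm (s * c) c) ⟩
  suc s * c + sum₁ (suc s) (λ t → f t ∸ c)               ∎
  where open ≤-Reasoning

from2 : (ℕ → ℕ) → ℕ → ℕ
from2 f (suc (suc t)) = f (suc (suc t))
from2 f _             = 0

sum₁≤f1+sum₁-from2 : ∀ s f → sum₁ s f ≤ f 1 + sum₁ s (from2 f)
sum₁≤f1+sum₁-from2 zero             f = z≤n
sum₁≤f1+sum₁-from2 (suc zero)       f = ≤-reflexive (sym (+-identityʳ (f 1)))
sum₁≤f1+sum₁-from2 (suc s@(suc _))  f =
  ≤-trans (+-monoˡ-≤ _ (sum₁≤f1+sum₁-from2 s f)) (≤-reflexive (+-assoc (f 1) _ _))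

-- harmonic! s e = s! · (e 1 / 1 + ⋯ + e s / s)
harmonic! : ℕ → (ℕ → ℕ) → ℕ
harmonic! zero    e = 0
harmonic! (suc s) e = suc s * harmonic! s e + s ! * e (suc s)

-- The bound at level t is raised to the power s!/t, then all levels are multiplied.
harmonic-product : ∀ {B Y C} s (D e : ℕ → ℕ) →
  (∀ t → 1 ≤ t → t ≤ s → B ^ (t * D t) * Y ^ e t ≤ C ^ e t) →
  B ^ (s ! * sum₁ s D) * Y ^ harmonic! s e ≤ C ^ harmonic! s e
harmonic-product zero D e h = ≤-refl
harmonic-product {B} {Y} {C} (suc s) D e h = begin
  B ^ (suc s ! * sum₁ (suc s) D) * Y ^ harmonic! (suc s) e
    ≡⟨ cong (λ u → B ^ u * Y ^ harmonic! (suc s) e) (split (suc s) (s !) (sum₁ s D) (D (suc s))) ⟩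
  B ^ (suc s * (s ! * sum₁ s D) + s ! * (suc s * D (suc s))) * Y ^ (suc s * H + s ! * e (suc s))
    ≡⟨ ^-combine₂ B Y (s ! * sum₁ s D) H (suc s * D (suc s)) (e (suc s)) (suc s) (s !) ⟩
  (B ^ (s ! * sum₁ s D) * Y ^ H) ^ suc s * (B ^ (suc s * D (suc s)) * Y ^ e (suc s)) ^ (s !)
    ≤⟨ *-mono-≤ (^-monoˡ-≤ (suc s) IH) (^-monoˡ-≤ (s !) (h (suc s) (s≤s z≤n) ≤-refl)) ⟩
  (C ^ H) ^ suc s * (C ^ e (suc s)) ^ (s !)
    ≡⟨ ^-combine C H (e (suc s)) (suc s) (s !) ⟨
  C ^ harmonic! (suc s) e ∎
  where
  open ≤-Reasoning
  H = harmonic! s e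
  IH = harmonic-product s D e (λ t 1≤t t≤s → h t 1≤t (m≤n⇒m≤1+n t≤s))
  split : ∀ m F S d → m * F * (S + d) ≡ m * (F * S) + F * (m * d)
  split = solve-∀

-- The inductive step multiplies both sides by P ^ F = (2t)^(α · (t+1)!), so that the
-- ratio ((t+1)/t)^(α (t+1)) bounded by step becomes an inequality between integers.
harmonic!-small : ∀ α β e →
  14 ^ (β * harmonic! 1 e) < (2 * 1) ^ (α * 1 !) * 5 ^ (β * harmonic! 1 e) →
  (∀ t → 14 ^ (β * e (suc (suc t))) * (2 * suc t) ^ (α * suc (suc t))
           ≤ 5 ^ (β * e (suc (suc t))) * (2 * suc (suc t)) ^ (α * suc (suc t))) →
  ∀ s → 14 ^ (β * harmonic! (suc s) e) < (2 * suc s) ^ (α * suc s !) * 5 ^ (β * harmonic! (suc s) e)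
harmonic!-small α β e base step zero    = base
harmonic!-small α β e base step (suc s) = *-cancelʳ-< (P ^ F) _ _ (begin-strict
  14 ^ (β * H′) * P ^ F                    ≡⟨ regroup-14 ⟩
  (14 ^ (β * H)) ^ m * (E₁₄ * P) ^ F       <⟨ *-monoˡ-< _ {{m^n≢0 _ F {{E₁₄P≢0}}}}
                                                (^-monoˡ-< m (harmonic!-small α β e base step s)) ⟩
  (W * A₅) ^ m * (E₁₄ * P) ^ F             ≤⟨ *-monoʳ-≤ ((W * A₅) ^ m) (^-monoˡ-≤ F (step s)) ⟩
  (W * A₅) ^ m * (E₅ * X) ^ F              ≡⟨ regroup-5 ⟨
  (2 * m) ^ (α * m !) * 5 ^ (β * H′) * P ^ F ∎)
  where
  open ≤-Reasoning
  t = suc s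
  m = suc t
  F = t !
  H = harmonic! t e
  H′ = harmonic! m e
  ε = e m
  P = (2 * t) ^ (α * m)
  X = (2 * m) ^ (α * m)
  W = (2 * t) ^ (α * F)
  A₅ = 5 ^ (β * H)
  E₅ = 5 ^ (β * ε)
  E₁₄ = 14 ^ (β * ε)
  E₁₄P≢0 : NonZero (E₁₄ * P)
  E₁₄P≢0 = m*n≢0 E₁₄ P {{m^n≢0 14 (β * ε)}} {{m^n≢0 (2 * t) (α * m)}}
  distrib : ∀ β m H F ε → β * (m * H + F * ε) ≡ m * (β * H) + F * (β * ε)
  distrib = solve-∀
  split : ∀ x → x ^ (β * H′) ≡ (x ^ (β * H)) ^ m * (x ^ (β * ε)) ^ F
  split x = trans (cong (x ^_) (distrib β m H F ε)) (^-combine x (β * H) (β * ε) m F)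
  shuffle : ∀ a b c d → a * (b * c) * d ≡ d * b * (c * a)
  shuffle = solve-∀
  2mᵅᵐ!≡Xᶠ : (2 * m) ^ (α * (m * F)) ≡ X ^ F
  2mᵅᵐ!≡Xᶠ = trans (cong ((2 * m) ^_) (sym (*-assoc α m F))) (sym (^-*-assoc (2 * m) (α * m) F))
  regroup-14 : 14 ^ (β * H′) * P ^ F ≡ (14 ^ (β * H)) ^ m * (E₁₄ * P) ^ F
  regroup-14 = begin-equality
    14 ^ (β * H′) * P ^ F                   ≡⟨ cong (_* P ^ F) (split 14) ⟩
    (14 ^ (β * H)) ^ m * E₁₄ ^ F * P ^ F    ≡⟨ *-assoc ((14 ^ (β * H)) ^ m) (E₁₄ ^ F) (P ^ F) ⟩
    (14 ^ (β * H)) ^ m * (E₁₄ ^ F * P ^ F)  ≡⟨ cong ((14 ^ (β * H)) ^ m *_) (^-distribʳ-* E₁₄ P F) ⟨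
    (14 ^ (β * H)) ^ m * (E₁₄ * P) ^ F      ∎
  regroup-5 : (2 * m) ^ (α * m !) * 5 ^ (β * H′) * P ^ F ≡ (W * A₅) ^ m * (E₅ * X) ^ F
  regroup-5 = begin-equality
    (2 * m) ^ (α * (m * F)) * 5 ^ (β * H′) * P ^ F   ≡⟨ cong₂ (λ u v → u * v * P ^ F) 2mᵅᵐ!≡Xᶠ (split 5) ⟩
    X ^ F * (A₅ ^ m * E₅ ^ F) * P ^ F               ≡⟨ cong (X ^ F * (A₅ ^ m * E₅ ^ F) *_) (^-*-swap (2 * t) α m F) ⟩
    X ^ F * (A₅ ^ m * E₅ ^ F) * W ^ m               ≡⟨ shuffle (X ^ F) (A₅ ^ m) (E₅ ^ F) (W ^ m) ⟩
    W ^ m * A₅ ^ m * (E₅ ^ F * X ^ F)               ≡⟨ cong₂ _*_ (^-distribʳ-* W A₅ m) (^-distribʳ-* E₅ X F) ⟨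
    (W * A₅) ^ m * (E₅ * X) ^ F                     ∎

harmonic!-small-step : ∀ {α a b} → a * 2 ^ α ≤ b * 5 ^ α → ∀ t →
  a * (2 * suc t) ^ (α * suc (suc t)) ≤ b * (2 * suc (suc t)) ^ (α * suc (suc t))
harmonic!-small-step {α} {a} {b} a2^α≤b5^α t = begin
  a * (2 * u) ^ M       ≡⟨ cong (a *_) (^-distribʳ-* 2 u M) ⟩
  a * (2 ^ M * u ^ M)   ≡⟨ x∙yz≈y∙xz a (2 ^ M) (u ^ M) ⟩
  2 ^ M * (a * u ^ M)   ≤⟨ *-monoʳ-≤ (2 ^ M) core ⟩
  2 ^ M * (b * w ^ M)   ≡⟨ x∙yz≈y∙xz (2 ^ M) b (w ^ M) ⟩
  b * (2 ^ M * w ^ M)   ≡⟨ cong (b *_) (^-distribʳ-* 2 w M) ⟨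
  b * (2 * w) ^ M       ∎
  where
  open ≤-Reasoning
  u = suc t
  w = suc u
  M = α * w
  pow : ∀ x → x ^ M ≡ (x ^ w) ^ α
  pow x = trans (cong (x ^_) (*-comm α w)) (sym (^-*-assoc x w α))
  core : a * u ^ M ≤ b * w ^ M
  core = *-cancelʳ-≤ _ _ (5 ^ α) {{m^n≢0 5 α}} (begin
    a * u ^ M * 5 ^ α             ≡⟨ cong (λ v → a * v * 5 ^ α) (pow u) ⟩
    a * (u ^ w) ^ α * 5 ^ α       ≡⟨ trans (cong (a *_) (^-distribʳ-* 5 (u ^ w) α)) (sym (xy∙z≈x∙zy a ((u ^ w) ^ α) (5 ^ α))) ⟨
    a * (5 * u ^ w) ^ α           ≤⟨ *-monoʳ-≤ a (^-monoˡ-≤ α (compound⁺≥5/2 u)) ⟩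
    a * (2 * w ^ w) ^ α           ≡⟨ trans (cong (a *_) (^-distribʳ-* 2 (w ^ w) α)) (sym (*-assoc a _ _)) ⟩
    a * 2 ^ α * (w ^ w) ^ α       ≤⟨ *-monoˡ-≤ _ a2^α≤b5^α ⟩
    b * 5 ^ α * (w ^ w) ^ α       ≡⟨ trans (cong (λ v → b * v * 5 ^ α) (pow w)) (xy∙z≈xz∙y b ((w ^ w) ^ α) (5 ^ α)) ⟨
    b * w ^ M * 5 ^ α             ∎)

levels-fail⇒harmonic!-large : ∀ {α β s n} (D e : ℕ → ℕ) .{{_ : NonZero s}} → s ≤ n →
  α * (s * s) ≤ β * sum₁ s D →
  (∀ t → 1 ≤ t → t ≤ s → (2 * n) ^ (t * D t) * (5 ^ (s * s)) ^ e t ≤ (14 ^ (s * s)) ^ e t) →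
  (2 * s) ^ (α * s !) * 5 ^ (β * harmonic! s e) ≤ 14 ^ (β * harmonic! s e)
levels-fail⇒harmonic!-large {α} {β} {s} {n} D e s≤n αq≤βΣD fails = ^-cancelˡ-≤ q {{m*n≢0 s s}} (begin
  ((2 * s) ^ (α * F) * 5 ^ (β * H)) ^ q          ≡⟨ ^-distribʳ-* _ _ q ⟩
  ((2 * s) ^ (α * F)) ^ q * (5 ^ (β * H)) ^ q    ≡⟨ cong₂ _*_ [2s]ᵅᶠ^q (^-comm 5 (β * H) q) ⟩
  (2 * s) ^ (α * (F * q)) * (5 ^ q) ^ (β * H)    ≤⟨ *-monoˡ-≤ _ (^-monoˡ-≤ (α * (F * q)) (*-monoʳ-≤ 2 s≤n)) ⟩
  (2 * n) ^ (α * (F * q)) * (5 ^ q) ^ (β * H)    ≡⟨ cong (λ v → (2 * n) ^ v * (5 ^ q) ^ (β * H)) (x∙yz≈y∙xz α F q) ⟩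
  (2 * n) ^ (F * (α * q)) * (5 ^ q) ^ (β * H)    ≤⟨ *-monoˡ-≤ _ (^-monoʳ-≤ (2 * n) {{2n≢0}} (*-monoʳ-≤ F αq≤βΣD)) ⟩
  (2 * n) ^ (F * (β * ΣD)) * (5 ^ q) ^ (β * H)   ≡⟨ cong₂ _*_ (cong ((2 * n) ^_) (x∙yz≈y∙xz F β ΣD)) (^-*-assoc′ (5 ^ q) β H) ⟩
  (2 * n) ^ (β * (F * ΣD)) * ((5 ^ q) ^ H) ^ β   ≡⟨ cong (_* ((5 ^ q) ^ H) ^ β) (^-*-assoc′ (2 * n) β (F * ΣD)) ⟩
  ((2 * n) ^ (F * ΣD)) ^ β * ((5 ^ q) ^ H) ^ β   ≡⟨ ^-distribʳ-* _ _ β ⟨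
  ((2 * n) ^ (F * ΣD) * (5 ^ q) ^ H) ^ β         ≤⟨ ^-monoˡ-≤ β (harmonic-product s D e fails) ⟩
  ((14 ^ q) ^ H) ^ β                             ≡⟨ trans (sym (^-*-assoc′ (14 ^ q) β H)) (^-comm 14 q (β * H)) ⟩
  (14 ^ (β * H)) ^ q                             ∎)
  where
  open ≤-Reasoning
  q = s * s
  F = s !
  H = harmonic! s e
  ΣD = sum₁ s D
  [2s]ᵅᶠ^q : ((2 * s) ^ (α * F)) ^ q ≡ (2 * s) ^ (α * (F * q))
  [2s]ᵅᶠ^q = trans (^-*-assoc (2 * s) (α * F) q) (cong ((2 * s) ^_) (*-assoc α F q))
  2n≢0 : NonZero (2 * n)
  2n≢0 = m*n≢0 2 n {{_}} {{>-nonZero (≤-trans (>-nonZero⁻¹ s) s≤n)}}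


-- Good levels

bounded-search : ∀ {P : ℕ → Set} → Decidable P → ∀ ℓ s →
  ¬ (∀ t → ℓ ≤ t → t ≤ s → ¬ P t) → ∃[ t ] ℓ ≤ t × t ≤ s × P t
bounded-search P? ℓ s not-none with anyUpTo? (λ t → (ℓ ≤? t) ×-dec P? t) (suc s)
... | yes (t , t<1+s , ℓ≤t , Pt) = t , ℓ≤t , s≤s⁻¹ t<1+s , Pt
... | no  none = contradiction (λ t ℓ≤t t≤s Pt → none (t , s≤s t≤s , ℓ≤t , Pt)) not-none

-- 14/5 stands in for e, see ExpLe-from-14/5.
GoodLevel : (s n : ℕ) (N : ℕ → ℕ) → ℕ → Set
GoodLevel s n N t = 14 ^ (s * s) ≤ 5 ^ (s * s) * (2 * n) ^ (t * (3 * N t ∸ s))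

GoodLevel? : ∀ s n N → Decidable (GoodLevel s n N)
GoodLevel? s n N t = 14 ^ (s * s) ≤? 5 ^ (s * s) * (2 * n) ^ (t * (3 * N t ∸ s))

GoodLevel⇒s<3N : ∀ {s n} N t .{{_ : NonZero s}} → GoodLevel s n N t → s < 3 * N t
GoodLevel⇒s<3N {s} {n} N t good with s <? 3 * N t
... | yes s<3N = s<3N
... | no  s≮3N = contradiction good (<⇒≱ (begin-strict
  5 ^ (s * s) * (2 * n) ^ (t * (3 * N t ∸ s))  ≡⟨ cong (λ e → 5 ^ (s * s) * (2 * n) ^ (t * e)) (m≤n⇒m∸n≡0 (≮⇒≥ s≮3N)) ⟩
  5 ^ (s * s) * (2 * n) ^ (t * 0)              ≡⟨ cong (λ e → 5 ^ (s * s) * (2 * n) ^ e) (*-zeroʳ t) ⟩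
  5 ^ (s * s) * 1                              ≡⟨ *-identityʳ _ ⟩
  5 ^ (s * s)                                  <⟨ ^-monoˡ-< (s * s) {{m*n≢0 s s}} (from-yes (5 <? 14)) ⟩
  14 ^ (s * s)                                 ∎))
  where open ≤-Reasoning

GoodLevel⇒bucket-bound : ∀ {s μ n} N t .{{_ : NonZero s}} .{{_ : NonZero μ}} → n ≡ s * μ →
  GoodLevel s n N t → n < 3 * μ * N t × ExpLe (n * n) ((2 * n) ^ (μ * t * (3 * μ * N t ∸ n)))
GoodLevel⇒bucket-bound {s} {μ} N t refl good = n<3μB , ExpLe-from-14/5 (n * n) _ scaled
  where
  n = s * μ
  B = N t
  D = 3 * B ∸ s
  comm3 : ∀ μ B → 3 * B * μ ≡ 3 * μ * B
  comm3 = solve-∀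
  square : ∀ s μ → s * μ * (s * μ) ≡ s * s * (μ * μ)
  square = solve-∀
  rearrange : ∀ μ t D → μ * t * (D * μ) ≡ t * D * (μ * μ)
  rearrange = solve-∀
  exponent : μ * t * (3 * μ * B ∸ n) ≡ t * D * (μ * μ)
  exponent = trans (cong (λ e → μ * t * (e ∸ n)) (sym (comm3 μ B)))
               (trans (cong (μ * t *_) (sym (*-distribʳ-∸ μ (3 * B) s))) (rearrange μ t D))
  n<3μB : n < 3 * μ * B
  n<3μB = subst (n <_) (comm3 μ B) (*-monoˡ-< μ (GoodLevel⇒s<3N {n = n} N t good))
  scaled : 14 ^ (n * n) ≤ 5 ^ (n * n) * (2 * n) ^ (μ * t * (3 * μ * B ∸ n))
  scaled = subst₂ (λ a e → 14 ^ a ≤ 5 ^ a * (2 * n) ^ e) (sym (square s μ)) (sym exponent)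
             (^-bound-scale {14} {5} {2 * n} {s * s} {t * D} (μ * μ) good)

¬GoodLevel⇒ : ∀ {s n N t} → ¬ GoodLevel s n N t →
  (2 * n) ^ (t * (3 * N t ∸ s)) * (5 ^ (s * s)) ^ 1 ≤ (14 ^ (s * s)) ^ 1
¬GoodLevel⇒ {s} {n} {N} {t} bad = begin
  (2 * n) ^ (t * (3 * N t ∸ s)) * (5 ^ (s * s)) ^ 1  ≡⟨ cong ((2 * n) ^ (t * (3 * N t ∸ s)) *_) (^-identityʳ _) ⟩
  (2 * n) ^ (t * (3 * N t ∸ s)) * 5 ^ (s * s)        ≡⟨ *-comm ((2 * n) ^ (t * (3 * N t ∸ s))) (5 ^ (s * s)) ⟩
  5 ^ (s * s) * (2 * n) ^ (t * (3 * N t ∸ s))        ≤⟨ <⇒≤ (≰⇒> bad) ⟩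
  14 ^ (s * s)                                       ≡⟨ ^-identityʳ _ ⟨
  (14 ^ (s * s)) ^ 1                                 ∎
  where open ≤-Reasoning

2s²≤sum₁[3N∸s] : ∀ s N → sum₁ s N ≡ s * s → 2 * (s * s) ≤ sum₁ s (λ t → 3 * N t ∸ s)
2s²≤sum₁[3N∸s] s N ΣN≡s² = +-cancelˡ-≤ (s * s) _ _ (begin
  3 * (s * s)                ≡⟨ cong (3 *_) ΣN≡s² ⟨
  3 * sum₁ s N               ≡⟨ sum₁-distribˡ-* 3 s N ⟨
  sum₁ s (λ t → 3 * N t)     ≤⟨ sum₁[f]≤s*c+sum₁[f∸c] s (λ t → 3 * N t) s ⟩
  s * s + sum₁ s (λ t → 3 * N t ∸ s) ∎)
  where open ≤-Reasoning

good-level-exists : ∀ {s n} (N : ℕ → ℕ) .{{_ : NonZero s}} → s ≤ n → sum₁ s N ≡ s * s →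
  ∃[ t ] 1 ≤ t × t ≤ s × GoodLevel s n N t
good-level-exists {s@(suc s′)} {n} N s≤n ΣN≡s² = bounded-search (GoodLevel? s n N) 1 s λ none →
  <⇒≱ (harmonic!-small 2 1 (λ _ → 1) (from-yes (14 <? 20))
         (harmonic!-small-step {2} {14} {5} (from-yes (14 * 2 ^ 2 ≤? 5 * 5 ^ 2))) s′)
      (levels-fail⇒harmonic!-large {2} {1} (λ t → 3 * N t ∸ s) (λ _ → 1) s≤n
         (≤-trans (2s²≤sum₁[3N∸s] s N ΣN≡s²) (≤-reflexive (sym (*-identityˡ _))))
         (λ t 1≤t t≤s → ¬GoodLevel⇒ {s} {n} {N} {t} (none t 1≤t t≤s)))

8s²≤7*sum₁-from2[3N∸s] : ∀ s N → sum₁ s N ≡ s * s → 7 * N 1 ≤ 2 * (s * s) →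
  8 * (s * s) ≤ 7 * sum₁ s (from2 (λ t → 3 * N t ∸ s))
8s²≤7*sum₁-from2[3N∸s] s N ΣN≡s² 7N₁≤2s² = +-cancelʳ-≤ (3 * (2 * q)) _ _ (begin
  8 * q + 3 * (2 * q)            ≡⟨ regroup q ⟩
  7 * (2 * q)                    ≤⟨ *-monoʳ-≤ 7 (2s²≤sum₁[3N∸s] s N ΣN≡s²) ⟩
  7 * sum₁ s D                   ≤⟨ *-monoʳ-≤ 7 (sum₁≤f1+sum₁-from2 s D) ⟩
  7 * (D 1 + ΣD′)                ≡⟨ *-distribˡ-+ 7 (D 1) ΣD′ ⟩
  7 * D 1 + 7 * ΣD′              ≤⟨ +-monoˡ-≤ (7 * ΣD′) (*-monoʳ-≤ 7 (m∸n≤m (3 * N 1) s)) ⟩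
  7 * (3 * N 1) + 7 * ΣD′        ≡⟨ cong (_+ 7 * ΣD′) (x∙yz≈y∙xz 7 3 (N 1)) ⟩
  3 * (7 * N 1) + 7 * ΣD′        ≤⟨ +-monoˡ-≤ (7 * ΣD′) (*-monoʳ-≤ 3 7N₁≤2s²) ⟩
  3 * (2 * q) + 7 * ΣD′          ≡⟨ +-comm (3 * (2 * q)) (7 * ΣD′) ⟩
  7 * ΣD′ + 3 * (2 * q)          ∎)
  where
  open ≤-Reasoning
  q = s * s
  D = λ t → 3 * N t ∸ s
  ΣD′ = sum₁ s (from2 D)
  regroup : ∀ q → 8 * q + 3 * (2 * q) ≡ 7 * (2 * q)
  regroup = solve-∀

good-level≥2-exists : ∀ {s n} (N : ℕ → ℕ) .{{_ : NonZero s}} → s ≤ n → sum₁ s N ≡ s * s →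
  7 * N 1 ≤ 2 * (s * s) → ∃[ t ] 2 ≤ t × t ≤ s × GoodLevel s n N t
good-level≥2-exists {s@(suc s′)} {n} N s≤n ΣN≡s² 7N₁≤2s² = bounded-search (GoodLevel? s n N) 2 s λ none →
  <⇒≱ (harmonic!-small 8 7 (from2 (λ _ → 1)) (from-yes (1 <? 256))
         (harmonic!-small-step {8} {14 ^ 7} {5 ^ 7} (from-yes (14 ^ 7 * 2 ^ 8 ≤? 5 ^ 7 * 5 ^ 8))) s′)
      (levels-fail⇒harmonic!-large {8} {7} (from2 D) (from2 (λ _ → 1)) s≤n
         (8s²≤7*sum₁-from2[3N∸s] s N ΣN≡s² 7N₁≤2s²) (fails none))
  where
  D = λ t → 3 * N t ∸ s
  fails : (∀ t → 2 ≤ t → t ≤ s → ¬ GoodLevel s n N t) → ∀ t → 1 ≤ t → t ≤ s →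
    (2 * n) ^ (t * from2 D t) * (5 ^ (s * s)) ^ from2 (λ _ → 1) t ≤ (14 ^ (s * s)) ^ from2 (λ _ → 1) t
  fails none (suc zero)      _ _   = ≤-refl
  fails none t@(suc (suc _)) _ t≤s = ¬GoodLevel⇒ {s} {n} {N} {t} (none t (s≤s (s≤s z≤n)) t≤s)


private variable
  A B : Set

𝟙 : Bool → ℕ
𝟙 true  = 1
𝟙 false = 0

∑ : List A → (A → ℕ) → ℕ
∑ xs f = sum (map f xs)

syntax ∑ xs (λ x → e) = ∑[ x ∈ xs ] e

∑-cong : ∀ (xs : List A) {f g : A → ℕ} → (∀ {x} → x ∈ xs → f x ≡ g x) → ∑ xs f ≡ ∑ xs g
∑-cong []       f≗g = refl
∑-cong (x ∷ xs) f≗g = cong₂ _+_ (f≗g (here refl)) (∑-cong xs (f≗g ∘ there))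

∑-mono-≤ : ∀ (xs : List A) {f g : A → ℕ} → (∀ {x} → x ∈ xs → f x ≤ g x) → ∑ xs f ≤ ∑ xs g
∑-mono-≤ []       f≤g = z≤n
∑-mono-≤ (x ∷ xs) f≤g = +-mono-≤ (f≤g (here refl)) (∑-mono-≤ xs (λ x∈xs → f≤g (there x∈xs)))

∑-const : ∀ (xs : List A) c → ∑[ x ∈ xs ] c ≡ length xs * c
∑-const []       c = refl
∑-const (x ∷ xs) c = cong (c +_) (∑-const xs c)

∑-distrib-+ : ∀ (xs : List A) (f g : A → ℕ) → ∑[ x ∈ xs ] (f x + g x) ≡ ∑ xs f + ∑ xs g
∑-distrib-+ []       f g = refl
∑-distrib-+ (x ∷ xs) f g = trans (cong (f x + g x +_) (∑-distrib-+ xs f g)) (+-CS.interchange (f x) (g x) _ _)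

∑-zero : ∀ (xs : List A) → ∑[ x ∈ xs ] 0 ≡ 0
∑-zero xs = trans (∑-const xs 0) (*-zeroʳ (length xs))

∑-comm : ∀ (xs : List A) (ys : List B) (h : A → B → ℕ) → ∑[ x ∈ xs ] ∑[ y ∈ ys ] h x y ≡ ∑[ y ∈ ys ] ∑[ x ∈ xs ] h x y
∑-comm []       ys h = sym (∑-zero ys)
∑-comm (x ∷ xs) ys h = trans (cong (∑ ys (h x) +_) (∑-comm xs ys h)) (sym (∑-distrib-+ ys (h x) _))

sum₁-∑-comm : ∀ s (xs : List A) (g : ℕ → A → ℕ) →
  sum₁ s (λ t → ∑[ x ∈ xs ] g t x) ≡ ∑[ x ∈ xs ] sum₁ s (λ t → g t x)
sum₁-∑-comm zero    xs g = sym (∑-zero xs)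
sum₁-∑-comm (suc s) xs g = trans (cong (_+ ∑ xs (g (suc s))) (sum₁-∑-comm s xs g)) (sym (∑-distrib-+ xs _ (g (suc s))))

module _ {P : Pred A 0ℓ} (P? : Decidable P) where

  length-filter≡∑𝟙 : ∀ xs → length (filter P? xs) ≡ ∑[ x ∈ xs ] 𝟙 (does (P? x))
  length-filter≡∑𝟙 []       = refl
  length-filter≡∑𝟙 (x ∷ xs) with does (P? x)
  ... | true  = cong suc (length-filter≡∑𝟙 xs)
  ... | false = length-filter≡∑𝟙 xs

  module _ (P-unique : ∀ {a b} → P a → P b → a ≡ b) where

    unique-length-filter≤1 : ∀ {xs} → Unique xs → length (filter P? xs) ≤ 1
    unique-length-filter≤1 {xs} xs! = at-most-one (filter⁺ P? xs!) (all-filter P? xs)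
      where
      at-most-one : ∀ {ys} → Unique ys → All P ys → length ys ≤ 1
      at-most-one []              _             = z≤n
      at-most-one (_ ∷ [])        _             = s≤s z≤n
      at-most-one ((a≢b ∷ _) ∷ _) (Pa ∷ Pb ∷ _) = contradiction (P-unique Pa Pb) a≢b

    unique-∑𝟙≡1 : ∀ {xs y} → Unique xs → y ∈ xs → P y → ∑[ x ∈ xs ] 𝟙 (does (P? x)) ≡ 1
    unique-∑𝟙≡1 {xs} xs! y∈xs Py = trans (sym (length-filter≡∑𝟙 xs))
      (≤-antisym (unique-length-filter≤1 xs!) (filter-some P? (lose y∈xs Py)))

sum₁-𝟙[≤] : ∀ x s → sum₁ s (λ t → 𝟙 (does (t ≤? x))) ≡ s ⊓ x
sum₁-𝟙[≤] x zero = refl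
sum₁-𝟙[≤] x (suc s) with suc s ≤? x
... | yes 1+s≤x = begin
  sum₁ s (λ t → 𝟙 (does (t ≤? x))) + 𝟙 (does (suc s ≤? x))
    ≡⟨ cong₂ _+_ (sum₁-𝟙[≤] x s) (cong 𝟙 (dec-true (suc s ≤? x) 1+s≤x)) ⟩
  s ⊓ x + 1   ≡⟨ cong (_+ 1) (m≤n⇒m⊓n≡m (<⇒≤ 1+s≤x)) ⟩
  s + 1       ≡⟨ +-comm s 1 ⟩
  suc s       ≡⟨ m≤n⇒m⊓n≡m 1+s≤x ⟨
  suc s ⊓ x   ∎
  where open ≡-Reasoning
... | no 1+s≰x = begin
  sum₁ s (λ t → 𝟙 (does (t ≤? x))) + 𝟙 (does (suc s ≤? x))
    ≡⟨ cong₂ _+_ (sum₁-𝟙[≤] x s) (cong 𝟙 (dec-false (suc s ≤? x) 1+s≰x)) ⟩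
  s ⊓ x + 0   ≡⟨ +-identityʳ _ ⟩
  s ⊓ x       ≡⟨ m≥n⇒m⊓n≡n x≤s ⟩
  x           ≡⟨ m≥n⇒m⊓n≡n (m≤n⇒m≤1+n x≤s) ⟨
  suc s ⊓ x   ∎
  where
  open ≡-Reasoning
  x≤s = s≤s⁻¹ (≰⇒> 1+s≰x)


-- Pair counts of a uniform multiset

≤-maxX : ∀ {x X} → x ∈ X → x ≤ maxX X
≤-maxX {X = y ∷ X} (here refl) = m≤m⊔n y (maxX X)
≤-maxX {X = y ∷ X} (there x∈X) = ≤-trans (≤-maxX x∈X) (m≤n⊔m y (maxX X))

size≡|supp|*μ : ∀ X → Uniform X → size X ≡ length (supp X) * μ X
size≡|supp|*μ X uniform = begin
  length X                                      ≡⟨ trans (∑-const X 1) (*-identityʳ _) ⟨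
  ∑[ y ∈ X ] 1                                  ≡⟨ ∑-cong X (λ y∈X → sym (supp-count y∈X)) ⟩
  ∑[ y ∈ X ] ∑[ d ∈ supp X ] 𝟙 (does (d ≟ y))   ≡⟨ ∑-comm X (supp X) _ ⟩
  ∑[ d ∈ supp X ] ∑[ y ∈ X ] 𝟙 (does (d ≟ y))   ≡⟨ ∑-cong (supp X) (λ {d} _ → length-filter≡∑𝟙 (d ≟_) X) ⟨
  ∑[ d ∈ supp X ] mult d X                      ≡⟨ ∑-cong (supp X) (λ d∈S → uniform _ (∈-deduplicate⁻ _≟_ X d∈S)) ⟩
  ∑[ d ∈ supp X ] μ X                           ≡⟨ ∑-const (supp X) (μ X) ⟩
  length (supp X) * μ X                         ∎
  where
  open ≡-Reasoning
  supp-count : ∀ {y} → y ∈ X → ∑[ d ∈ supp X ] 𝟙 (does (d ≟ y)) ≡ 1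
  supp-count {y} y∈X =
    unique-∑𝟙≡1 (_≟ y) (λ a≡y b≡y → trans a≡y (sym b≡y)) (deduplicate-! X) (∈-deduplicate⁺ _≟_ y∈X) refl

pairCount≤|supp| : ∀ X z → pairCount X z ≤ length (supp X)
pairCount≤|supp| X z = begin
  pairCount X z          ≤⟨ ∑-mono-≤ (supp X) (λ {x} _ → unique-length-filter≤1 (λ x′ → x + x′ ≟ z)
                              (λ p q → +-cancelˡ-≡ x _ _ (trans p (sym q))) (deduplicate-! X)) ⟩
  ∑[ x ∈ supp X ] 1      ≡⟨ trans (∑-const (supp X) 1) (*-identityʳ _) ⟩
  length (supp X)        ∎
  where open ≤-Reasoning

sumRange : List ℕ → List ℕ
sumRange X = upTo (suc (2 * maxX X))

∑-pairCount : ∀ X → ∑[ z ∈ sumRange X ] pairCount X z ≡ length (supp X) * length (supp X)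
∑-pairCount X = begin
  ∑[ z ∈ Z ] ∑[ x ∈ S ] length (filter (λ x′ → x + x′ ≟ z) S)
    ≡⟨ ∑-cong Z (λ {z} _ → ∑-cong S (λ {x} _ → length-filter≡∑𝟙 (λ x′ → x + x′ ≟ z) S)) ⟩
  ∑[ z ∈ Z ] ∑[ x ∈ S ] ∑[ x′ ∈ S ] 𝟙 (does (x + x′ ≟ z))          ≡⟨ ∑-comm Z S _ ⟩
  ∑[ x ∈ S ] ∑[ z ∈ Z ] ∑[ x′ ∈ S ] 𝟙 (does (x + x′ ≟ z))          ≡⟨ ∑-cong S (λ {x} _ → ∑-comm Z S _) ⟩
  ∑[ x ∈ S ] ∑[ x′ ∈ S ] ∑[ z ∈ Z ] 𝟙 (does (x + x′ ≟ z))          ≡⟨ ∑-cong S (λ x∈S → ∑-cong S (λ x′∈S → one-sum x∈S x′∈S)) ⟩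
  ∑[ x ∈ S ] ∑[ x′ ∈ S ] 1                                         ≡⟨ ∑-cong S (λ _ → trans (∑-const S 1) (*-identityʳ _)) ⟩
  ∑[ x ∈ S ] length S                                              ≡⟨ ∑-const S (length S) ⟩
  length S * length S                                              ∎
  where
  open ≡-Reasoning
  S = supp X
  Z = sumRange X
  ≤-max : ∀ {x} → x ∈ S → x ≤ maxX X
  ≤-max x∈S = ≤-maxX (∈-deduplicate⁻ _≟_ X x∈S)
  one-sum : ∀ {x x′} → x ∈ S → x′ ∈ S → ∑[ z ∈ Z ] 𝟙 (does (x + x′ ≟ z)) ≡ 1
  one-sum {x} {x′} x∈S x′∈S = unique-∑𝟙≡1 (x + x′ ≟_) (λ p q → trans (sym p) q) (upTo⁺ _)
    (∈-upTo⁺ (s≤s (+-mono-≤ (≤-max x∈S) (≤-trans (≤-max x′∈S) (m≤m+n (maxX X) 0))))) refl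

levelCount : List ℕ → ℕ → ℕ
levelCount X t = length (filter (λ z → t ≤? pairCount X z) (sumRange X))

sum₁-levelCount : ∀ X → sum₁ (length (supp X)) (levelCount X) ≡ length (supp X) * length (supp X)
sum₁-levelCount X = begin
  sum₁ s (levelCount X)                                ≡⟨ sum₁-cong s (λ t → length-filter≡∑𝟙 (λ z → t ≤? pairCount X z) Z) ⟩
  sum₁ s (λ t → ∑[ z ∈ Z ] 𝟙 (does (t ≤? pairCount X z))) ≡⟨ sum₁-∑-comm s Z _ ⟩
  ∑[ z ∈ Z ] sum₁ s (λ t → 𝟙 (does (t ≤? pairCount X z))) ≡⟨ ∑-cong Z (λ {z} _ → sum₁-𝟙[≤] (pairCount X z) s) ⟩
  ∑[ z ∈ Z ] (s ⊓ pairCount X z)                        ≡⟨ ∑-cong Z (λ {z} _ → m≥n⇒m⊓n≡n (pairCount≤|supp| X z)) ⟩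
  ∑[ z ∈ Z ] pairCount X z                              ≡⟨ ∑-pairCount X ⟩
  s * s                                                 ∎
  where
  open ≡-Reasoning
  s = length (supp X)
  Z = sumRange X

pairCount-0≡0 : ∀ X → All (0 <_) X → pairCount X 0 ≡ 0
pairCount-0≡0 X pos = trans (∑-cong (supp X) no-pairs) (∑-zero (supp X))
  where
  x+x′≢0 : ∀ {x x′} → x ∈ supp X → x + x′ ≢ 0
  x+x′≢0 {x} x∈S x+x′≡0 = n≮0 (subst (0 <_) (m+n≡0⇒m≡0 x x+x′≡0) (All.lookup pos (∈-deduplicate⁻ _≟_ X x∈S)))
  no-pairs : ∀ {x} → x ∈ supp X → length (filter (λ x′ → x + x′ ≟ 0) (supp X)) ≡ 0
  no-pairs {x} x∈S = cong length (filter-none (λ x′ → x + x′ ≟ 0) {supp X} (All.tabulate (λ _ → x+x′≢0 x∈S)))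

levelCount-1≤2*maxX : ∀ X → All (0 <_) X → levelCount X 1 ≤ 2 * maxX X
levelCount-1≤2*maxX X pos = begin
  length (filter P? (0 ∷ applyUpTo suc (2 * maxX X)))  ≡⟨ cong length (filter-reject P? 1≰r₀) ⟩
  length (filter P? (applyUpTo suc (2 * maxX X)))      ≤⟨ length-filter P? (applyUpTo suc (2 * maxX X)) ⟩
  length (applyUpTo suc (2 * maxX X))                  ≡⟨ length-applyUpTo suc (2 * maxX X) ⟩
  2 * maxX X                                           ∎
  where
  open ≤-Reasoning
  P? = λ z → 1 ≤? pairCount X z
  1≰r₀ : ¬ 1 ≤ pairCount X 0
  1≰r₀ 1≤r₀ = n≮0 (subst (1 ≤_) (pairCount-0≡0 X pos) 1≤r₀)

bucketSize-μ* : ∀ X t .{{_ : NonZero (μ X)}} → bucketSize (μ X * t) X ≡ levelCount X t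
bucketSize-μ* X t = cong length (filter-≐ (λ z → μ X * t ≤? f X z) (λ z → t ≤? pairCount X z)
                                   (*-cancelˡ-≤ (μ X) , *-monoʳ-≤ (μ X)) (sumRange X))

module NonemptyUniform {X : List ℕ} (uniform : Uniform X) {{size≢0 : NonZero (size X)}} where

  s = length (supp X)

  n≡sμ : size X ≡ s * μ X
  n≡sμ = size≡|supp|*μ X uniform

  instance
    s≢0 : NonZero s
    s≢0 = m*n≢0⇒m≢0 s {{subst NonZero n≡sμ size≢0}}
    μ≢0 : NonZero (μ X)
    μ≢0 = m*n≢0⇒n≢0 s {{subst NonZero n≡sμ size≢0}}

  s≤n : s ≤ size X
  s≤n = subst (s ≤_) (sym n≡sμ) (m≤m*n s (μ X))

  witness : ∀ {t} → 1 < μ X * t → t ≤ s → GoodLevel s (size X) (levelCount X) t →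
    Σ ℕ (λ v → (1 < v) × (v ≤ size X) × BucketBound v X)
  witness {t} 1<μt t≤s good = μ X * t , 1<μt , μt≤n , bound
    where
    μt≤n : μ X * t ≤ size X
    μt≤n = subst (μ X * t ≤_) (trans (*-comm (μ X) s) (sym n≡sμ)) (*-monoʳ-≤ (μ X) t≤s)
    bound : BucketBound (μ X * t) X
    bound rewrite bucketSize-μ* X t {{μ≢0}} = GoodLevel⇒bucket-bound {s} {μ X} (levelCount X) t n≡sμ good

  7*levelCount-1≤2s² : All (0 <_) X → Dense 7 X → ¬ 2 ≤ μ X → 7 * levelCount X 1 ≤ 2 * (s * s)
  7*levelCount-1≤2s² pos dense μ≱2 = begin
    7 * levelCount X 1       ≤⟨ *-monoʳ-≤ 7 (levelCount-1≤2*maxX X pos) ⟩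
    7 * (2 * maxX X)         ≡⟨ x∙yz≈y∙xz 7 2 (maxX X) ⟩
    2 * (7 * maxX X)         ≡⟨ cong (λ u → 2 * (7 * u * maxX X)) μ≡1 ⟨
    2 * (7 * μ X * maxX X)   ≤⟨ *-monoʳ-≤ 2 dense ⟩
    2 * (size X * size X)    ≡⟨ cong (λ n → 2 * (n * n)) (trans n≡sμ (trans (cong (s *_) μ≡1) (*-identityʳ s))) ⟩
    2 * (s * s)              ∎
    where
    open ≤-Reasoning
    μ≡1 : μ X ≡ 1
    μ≡1 = ≤-antisym (s≤s⁻¹ (≰⇒> μ≱2)) (>-nonZero⁻¹ (μ X))

lemma4p25 : (X : List ℕ) → ¬ (X ≡ []) → All (λ x → 0 < x) X → Uniform X → Dense 7 X →
    Σ ℕ (λ v → (1 < v) × (v ≤ size X) × BucketBound v X)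
lemma4p25 []        X≢[] _   _       _     = contradiction refl X≢[]
lemma4p25 X@(_ ∷ _) _    pos uniform dense with 2 ≤? μ X
... | yes 2≤μ =
  let t , 1≤t , t≤s , good = good-level-exists (levelCount X) s≤n (sum₁-levelCount X)
  in  witness (≤-trans 2≤μ (m≤m*n (μ X) t {{>-nonZero 1≤t}})) t≤s good
  where open NonemptyUniform uniform
... | no μ≱2 =
  let t , 2≤t , t≤s , good = good-level≥2-exists (levelCount X) s≤n (sum₁-levelCount X)
                                (7*levelCount-1≤2s² pos dense μ≱2)
  in  witness (≤-trans 2≤t (m≤n*m t (μ X))) t≤s good
  where open NonemptyUniform uniform
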